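{- For every integer $b>1$, there is a set $A$ of integers such that $|hA|=2(h^2+1)$ for all integers $1\le h\le b$.
   Context: For a finite set $A\subseteq\mathbb{Z}$ and a positive integer $h$, the $h$-fold sumset is $hA=\{x_1+\dots+x_h : x_i\in A\}$. -}

module Defs where

open import Data.Nat using (ℕ)
open import Data.Integer using (ℤ; _+_; +_)
open import Data.List using (List; length)
open import Data.List.Membership.Propositional using (_∈_)
open import Data.List.Relation.Unary.Unique.Propositional using (Unique)
open import Data.Vec using (Vec; foldr)
import Data.Vec.Relation.Unary.All as VAll
open import Data.Product using (Σ; ∃; _×_)
open import Function.Bundles using (_⇔_)
open import Relation.Binary.PropositionalEquality using (_≡_)

-- A finite set of integers is represented by a list (duplicates irrelevant).
-- Sum of a vector of integers.
vsum : ∀ {n} → Vec ℤ n → ℤ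
vsum = foldr _ _+_ (+ 0)

InSumset : ℕ → List ℤ → ℤ → Set
InSumset h A x = Σ (Vec ℤ h) λ xs → VAll.All (_∈ A) xs × vsum xs ≡ x

HasSize : (ℤ → Set) → ℕ → Set
HasSize P n = Σ (List ℤ) λ L → Unique L × length L ≡ n × (∀ x → (x ∈ L) ⇔ P x)

-- With A = {0, 1, M, M + 3}, a sum of h elements of A using k copies of M + 3,
-- i − k copies of M and l copies of 1 equals i·M + (3k + l), where k ≤ i and
-- i + l ≤ h.  For 3h < M these sums fall into disjoint layers i·M + [0, M),
-- and layer i is a translate of the grid G(i, r) = {3k + l | k ≤ i, l ≤ r}
-- with r = h − i.  That grid has i + 1 elements for r = 0, 2(i + 1) for r = 1,
-- and is the whole interval [0, 3i + r] for r ≥ 2.  Summing over i gives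
-- (h − 1)(2h − 1) + 2h + (h + 1) = 2(h² + 1).
module Submission where

open import Defs
open import Data.Nat using (ℕ; zero; suc; _<_; _≤_; _*_; _+_; z≤n; s≤s; _≤?_)
open import Data.Nat.Properties
open import Data.Nat.Tactic.RingSolver using (solve-∀)
open import Data.Integer using (ℤ; +_) renaming (_+_ to _+ℤ_)
import Data.Integer.Properties as ℤ
open import Data.List using (List; []; _∷_; _++_; map; upTo; length)
open import Data.List.Properties using (length-map; length-++; length-upTo)
open import Data.List.Membership.Propositional using (_∈_)
open import Data.List.Membership.Propositional.Properties
  using (∈-map⁺; ∈-map⁻; ∈-++⁻; ∈-++⁺ˡ; ∈-++⁺ʳ; ∈-upTo⁺; ∈-upTo⁻)
open import Data.List.Relation.Binary.Disjoint.Propositional using (Disjoint)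
open import Data.List.Relation.Unary.Any using (here; there)
open import Data.List.Relation.Unary.Unique.Propositional using (Unique)
import Data.List.Relation.Unary.Unique.Propositional.Properties as Unique
open import Data.Vec using (Vec; []; _∷_)
open import Data.Vec.Relation.Unary.All using ([]; _∷_)
import Data.Vec.Relation.Unary.All as Vec
open import Data.Product using (Σ; ∃₂; _×_; _,_)
open import Data.Sum using (inj₁; inj₂)
open import Function using (_∘_)
open import Function.Bundles using (_⇔_; mk⇔)
open import Relation.Nullary using (yes; no)
open import Relation.Binary.PropositionalEquality
  using (_≡_; _≢_; refl; sym; trans; cong; cong₂; subst; module ≡-Reasoning)

separated⇒disjoint : ∀ {xs ys : List ℕ} c →
  (∀ {x} → x ∈ xs → x < c) → (∀ {y} → y ∈ ys → c ≤ y) → Disjoint xs ys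
separated⇒disjoint c below above (x∈xs , x∈ys) = <⇒≱ (below x∈xs) (above x∈ys)

InGrid : ℕ → ℕ → ℕ → Set
InGrid i r t = ∃₂ λ k l → k ≤ i × l ≤ r × t ≡ k * 3 + l

inGrid-≤ : ∀ {i r t} → InGrid i r t → t ≤ i * 3 + r
inGrid-≤ (k , l , k≤i , l≤r , refl) = +-mono-≤ (*-monoˡ-≤ 3 k≤i) l≤r

inGrid-interval : ∀ i r t → t ≤ i * 3 + (2 + r) → InGrid i (2 + r) t
inGrid-interval i r zero _ = 0 , 0 , z≤n , z≤n , refl
inGrid-interval i r (suc t) t<bound with inGrid-interval i r t (<⇒≤ t<bound)
... | k , l , k≤i , l≤2+r , refl with l ≤? suc r
...   | yes l≤1+r = k , suc l , k≤i , s≤s l≤1+r , sym (+-suc (k * 3) l)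
...   | no l≰1+r with ≤-antisym l≤2+r (≰⇒> l≰1+r)
...     | refl = suc k , r , k<i , ≤-trans (n≤1+n r) (n≤1+n (suc r)) , carry k r
  where
  k<i : k < i
  k<i = *-cancelʳ-< 3 k i (+-cancelʳ-< (2 + r) (k * 3) (i * 3) t<bound)
  carry : ∀ k r → suc (k * 3 + (2 + r)) ≡ suc k * 3 + r
  carry = solve-∀

multiples : ℕ → List ℕ
multiples i = map (_* 3) (upTo (suc i))

∈-multiples⁺ : ∀ {i k} → k ≤ i → k * 3 ∈ multiples i
∈-multiples⁺ k≤i = ∈-map⁺ (_* 3) (∈-upTo⁺ (s≤s k≤i))

∈-multiples⁻ : ∀ {i t} → t ∈ multiples i → Σ ℕ λ k → k ≤ i × t ≡ k * 3
∈-multiples⁻ t∈ with ∈-map⁻ (_* 3) t∈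
... | k , k∈ , t≡ = k , ≤-pred (∈-upTo⁻ k∈) , t≡

multiples-unique : ∀ i → Unique (multiples i)
multiples-unique i = Unique.map⁺ (λ {m} {n} → *-cancelʳ-≡ m n 3) (Unique.upTo⁺ (suc i))

multiple≢suc-multiple : ∀ k k′ → k * 3 ≢ suc (k′ * 3)
multiple≢suc-multiple (suc k) (suc k′) eq =
  multiple≢suc-multiple k k′ (suc-injective (suc-injective (suc-injective eq)))

+-suc-suc : ∀ m r → m + (2 + r) ≡ 2 + (m + r)
+-suc-suc = solve-∀

grid : ℕ → ℕ → List ℕ
grid i zero = multiples i
grid i (suc zero) = multiples i ++ map suc (multiples i)
grid i (suc (suc r)) = upTo (3 + (i * 3 + r))

gridSize : ℕ → ℕ → ℕ
gridSize i zero = suc i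
gridSize i (suc zero) = suc i + suc i
gridSize i (suc (suc r)) = 3 + (i * 3 + r)

grid-sound : ∀ i r {t} → t ∈ grid i r → InGrid i r t
grid-sound i zero t∈ with ∈-multiples⁻ t∈
... | k , k≤i , refl = k , 0 , k≤i , z≤n , sym (+-identityʳ (k * 3))
grid-sound i (suc zero) t∈ with ∈-++⁻ (multiples i) t∈
... | inj₁ t∈₀ = let k , k≤i , t≡ = ∈-multiples⁻ t∈₀
                 in k , 0 , k≤i , z≤n , trans t≡ (sym (+-identityʳ (k * 3)))
... | inj₂ t∈₁ with ∈-map⁻ suc t∈₁
...   | u , u∈ , refl = let k , k≤i , u≡ = ∈-multiples⁻ u∈
                        in k , 1 , k≤i , s≤s z≤n , trans (cong suc u≡) (+-comm 1 (k * 3))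
grid-sound i (suc (suc r)) {t} t∈ =
  inGrid-interval i r t (subst (t ≤_) (sym (+-suc-suc (i * 3) r)) (≤-pred (∈-upTo⁻ t∈)))

grid-complete : ∀ i r {t} → InGrid i r t → t ∈ grid i r
grid-complete i zero (k , .0 , k≤i , z≤n , refl) =
  subst (_∈ multiples i) (sym (+-identityʳ (k * 3))) (∈-multiples⁺ k≤i)
grid-complete i (suc zero) (k , zero , k≤i , _ , refl) =
  ∈-++⁺ˡ (subst (_∈ multiples i) (sym (+-identityʳ (k * 3))) (∈-multiples⁺ k≤i))
grid-complete i (suc zero) (k , suc zero , k≤i , _ , refl) =
  ∈-++⁺ʳ (multiples i) (subst (_∈ map suc (multiples i)) (+-comm 1 (k * 3))
                          (∈-map⁺ suc (∈-multiples⁺ k≤i)))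
grid-complete i (suc zero) (_ , suc (suc _) , _ , s≤s () , _)
grid-complete i (suc (suc r)) {t} t∈G =
  ∈-upTo⁺ (s≤s (subst (t ≤_) (+-suc-suc (i * 3) r) (inGrid-≤ t∈G)))

grid-unique : ∀ i r → Unique (grid i r)
grid-unique i zero = multiples-unique i
grid-unique i (suc zero) =
  Unique.++⁺ (multiples-unique i) (Unique.map⁺ suc-injective (multiples-unique i)) disjoint
  where
  disjoint : Disjoint (multiples i) (map suc (multiples i))
  disjoint (v∈₀ , v∈₁) with ∈-multiples⁻ v∈₀ | ∈-map⁻ suc v∈₁
  ... | k , _ , v≡ | u , u∈ , refl with ∈-multiples⁻ u∈
  ...   | k′ , _ , refl = multiple≢suc-multiple k k′ (sym v≡)
grid-unique i (suc (suc r)) = Unique.upTo⁺ _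

length-multiples : ∀ i → length (multiples i) ≡ suc i
length-multiples i = trans (length-map (_* 3) (upTo (suc i))) (length-upTo (suc i))

length-grid : ∀ i r → length (grid i r) ≡ gridSize i r
length-grid i zero = length-multiples i
length-grid i (suc zero) = trans (length-++ (multiples i))
  (cong₂ _+_ (length-multiples i) (trans (length-map suc (multiples i)) (length-multiples i)))
length-grid i (suc (suc r)) = length-upTo _

+1-expansion : ∀ M i k l → 1 + (i * M + (k * 3 + l)) ≡ i * M + (k * 3 + suc l)
+1-expansion = solve-∀

+M-expansion : ∀ M i k l → M + (i * M + (k * 3 + l)) ≡ suc i * M + (k * 3 + l)
+M-expansion = solve-∀

+M+3-expansion : ∀ M i k l → M + 3 + (i * M + (k * 3 + l)) ≡ suc i * M + (suc k * 3 + l)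
+M+3-expansion = solve-∀

module Layers (M : ℕ) where

  layer : ℕ → ℕ → List ℕ
  layer i r = map (_+_ (i * M)) (grid i r)

  -- Layer i of  layers j r  is built on the grid G(i, j + r − i).
  layers : ℕ → ℕ → List ℕ
  layers zero r = layer 0 r
  layers (suc j) r = layers j (suc r) ++ layer (suc j) r

  record Expansion (j n x : ℕ) : Set where
    constructor expansion
    field
      i k l : ℕ
      i≤j : i ≤ j
      k≤i : k ≤ i
      i+l≤n : i + l ≤ n
      x≡ : x ≡ i * M + (k * 3 + l)

  layer-sound : ∀ i r {x} → x ∈ layer i r → Expansion i (i + r) x
  layer-sound i r x∈ with ∈-map⁻ (_+_ (i * M)) x∈
  ... | t , t∈ , refl with grid-sound i r t∈
  ...   | k , l , k≤i , l≤r , refl = expansion i k l ≤-refl k≤i (+-monoʳ-≤ i l≤r) refl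

  layer-complete : ∀ {i r k l} → k ≤ i → l ≤ r → i * M + (k * 3 + l) ∈ layer i r
  layer-complete {i} {r} {k} {l} k≤i l≤r =
    ∈-map⁺ (_+_ (i * M)) (grid-complete i r (k , l , k≤i , l≤r , refl))

  layers-sound : ∀ j r {x} → x ∈ layers j r → Expansion j (j + r) x
  layers-sound zero r x∈ = layer-sound 0 r x∈
  layers-sound (suc j) r x∈ with ∈-++⁻ (layers j (suc r)) x∈
  ... | inj₂ x∈top = layer-sound (suc j) r x∈top
  ... | inj₁ x∈rest with layers-sound j (suc r) x∈rest
  ...   | expansion i k l i≤j k≤i i+l≤n x≡ =
    expansion i k l (m≤n⇒m≤1+n i≤j) k≤i (subst (i + l ≤_) (+-suc j r) i+l≤n) x≡

  layers-complete : ∀ j r {x} → Expansion j (j + r) x → x ∈ layers j r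
  layers-complete zero r (expansion _ k l z≤n k≤i l≤r refl) = layer-complete k≤i l≤r
  layers-complete (suc j) r (expansion i k l i≤1+j k≤i i+l≤n refl) with m≤n⇒m<n∨m≡n i≤1+j
  ... | inj₂ refl =
    ∈-++⁺ʳ (layers j (suc r)) (layer-complete k≤i (+-cancelˡ-≤ (suc j) _ _ i+l≤n))
  ... | inj₁ (s≤s i≤j) =
    ∈-++⁺ˡ (layers-complete j (suc r)
             (expansion i k l i≤j k≤i (subst (i + l ≤_) (sym (+-suc j r)) i+l≤n) refl))

  expansion-< : ∀ {j n x} → n * 3 < M → Expansion j n x → x < suc j * M
  expansion-< {j} {n} n*3<M (expansion i k l i≤j k≤i i+l≤n refl) = begin-strict
    i * M + (k * 3 + l) <⟨ +-monoʳ-< (i * M) (≤-<-trans digits≤ n*3<M) ⟩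
    i * M + M           ≡⟨ +-comm (i * M) M ⟩
    suc i * M           ≤⟨ *-monoˡ-≤ M (s≤s i≤j) ⟩
    suc j * M           ∎
    where
    open ≤-Reasoning
    digits≤ : k * 3 + l ≤ n * 3
    digits≤ = begin
      k * 3 + l     ≤⟨ +-mono-≤ (*-monoˡ-≤ 3 k≤i) (m≤m*n l 3) ⟩
      i * 3 + l * 3 ≡⟨ *-distribʳ-+ 3 i l ⟨
      (i + l) * 3   ≤⟨ *-monoˡ-≤ 3 i+l≤n ⟩
      n * 3         ∎

  layer-≥ : ∀ i r {x} → x ∈ layer i r → i * M ≤ x
  layer-≥ i r x∈ with ∈-map⁻ (_+_ (i * M)) x∈
  ... | t , _ , refl = m≤m+n (i * M) t

  layer-unique : ∀ i r → Unique (layer i r)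
  layer-unique i r = Unique.map⁺ (+-cancelˡ-≡ (i * M) _ _) (grid-unique i r)

  layers-unique : ∀ j r → (j + r) * 3 < M → Unique (layers j r)
  layers-unique zero r _ = layer-unique 0 r
  layers-unique (suc j) r bound =
    Unique.++⁺ (layers-unique j (suc r) bound′) (layer-unique (suc j) r)
      (separated⇒disjoint (suc j * M)
        (λ x∈ → expansion-< bound′ (layers-sound j (suc r) x∈)) (layer-≥ (suc j) r))
    where
    bound′ : (j + suc r) * 3 < M
    bound′ = subst (λ n → n * 3 < M) (sym (+-suc j r)) bound

  length-layer : ∀ i r → length (layer i r) ≡ gridSize i r
  length-layer i r = trans (length-map (_+_ (i * M)) (grid i r)) (length-grid i r)

  length-layers : ∀ j r → length (layers j (2 + r)) ≡ j * suc j + suc j * (j + r + 3)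
  length-layers zero r = trans (length-layer 0 (2 + r)) (closed-form r)
    where
    closed-form : ∀ r → 3 + (0 * 3 + r) ≡ 0 * 1 + 1 * (0 + r + 3)
    closed-form = solve-∀
  length-layers (suc j) r = begin
    length (layers j (3 + r) ++ layer (suc j) (2 + r))
      ≡⟨ length-++ (layers j (3 + r)) ⟩
    length (layers j (3 + r)) + length (layer (suc j) (2 + r))
      ≡⟨ cong₂ _+_ (length-layers j (suc r)) (length-layer (suc j) (2 + r)) ⟩
    j * suc j + suc j * (j + suc r + 3) + (3 + (suc j * 3 + r))
      ≡⟨ closed-form j r ⟩
    suc j * suc (suc j) + suc (suc j) * (suc j + r + 3) ∎
    where
    open ≡-Reasoning
    closed-form : ∀ j r → j * suc j + suc j * (j + suc r + 3) + (3 + (suc j * 3 + r))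
                          ≡ suc j * suc (suc j) + suc (suc j) * (suc j + r + 3)
    closed-form = solve-∀

  length-layers-0 : ∀ h → 1 ≤ h → length (layers h 0) ≡ 2 * (h * h + 1)
  length-layers-0 (suc zero) _ = refl
  length-layers-0 (suc (suc g)) _ = begin
    length ((layers g 2 ++ layer (suc g) 1) ++ layer (2 + g) 0)
      ≡⟨ length-++ (layers g 2 ++ layer (suc g) 1) ⟩
    length (layers g 2 ++ layer (suc g) 1) + length (layer (2 + g) 0)
      ≡⟨ cong (_+ length (layer (2 + g) 0)) (length-++ (layers g 2)) ⟩
    length (layers g 2) + length (layer (suc g) 1) + length (layer (2 + g) 0)
      ≡⟨ cong₂ _+_ (cong₂ _+_ (length-layers g 0) (length-layer (suc g) 1))
                   (length-layer (2 + g) 0) ⟩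
    g * suc g + suc g * (g + 0 + 3) + (2 + g + (2 + g)) + (3 + g)
      ≡⟨ closed-form g ⟩
    2 * ((2 + g) * (2 + g) + 1) ∎
    where
    open ≡-Reasoning
    closed-form : ∀ g → g * suc g + suc g * (g + 0 + 3) + (2 + g + (2 + g)) + (3 + g)
                        ≡ 2 * ((2 + g) * (2 + g) + 1)
    closed-form = solve-∀

  A : List ℤ
  A = + 0 ∷ + 1 ∷ + M ∷ + (M + 3) ∷ []

  expansion-+0 : ∀ {h x} → Expansion h h x → Expansion (suc h) (suc h) x
  expansion-+0 (expansion i k l i≤h k≤i i+l≤h x≡) =
    expansion i k l (m≤n⇒m≤1+n i≤h) k≤i (m≤n⇒m≤1+n i+l≤h) x≡

  expansion-+1 : ∀ {h x} → Expansion h h x → Expansion (suc h) (suc h) (1 + x)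
  expansion-+1 {h} (expansion i k l i≤h k≤i i+l≤h refl) =
    expansion i k (suc l) (m≤n⇒m≤1+n i≤h) k≤i (subst (_≤ suc h) (sym (+-suc i l)) (s≤s i+l≤h))
      (+1-expansion M i k l)

  expansion-+M : ∀ {h x} → Expansion h h x → Expansion (suc h) (suc h) (M + x)
  expansion-+M (expansion i k l i≤h k≤i i+l≤h refl) =
    expansion (suc i) k l (s≤s i≤h) (m≤n⇒m≤1+n k≤i) (s≤s i+l≤h) (+M-expansion M i k l)

  expansion-+M+3 : ∀ {h x} → Expansion h h x → Expansion (suc h) (suc h) (M + 3 + x)
  expansion-+M+3 (expansion i k l i≤h k≤i i+l≤h refl) =
    expansion (suc i) (suc k) l (s≤s i≤h) (s≤s k≤i) (s≤s i+l≤h) (+M+3-expansion M i k l)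

  sumset⇒expansion : ∀ h (xs : Vec ℤ h) → Vec.All (_∈ A) xs →
                     Σ ℕ λ y → vsum xs ≡ + y × Expansion h h y
  sumset⇒expansion zero [] [] = 0 , refl , expansion 0 0 0 z≤n z≤n z≤n refl
  sumset⇒expansion (suc h) (a ∷ xs) (a∈A ∷ xs⊆A) with sumset⇒expansion h xs xs⊆A | a∈A
  ... | y , vsum≡ , e | here refl = y , cong (+ 0 +ℤ_) vsum≡ , expansion-+0 e
  ... | y , vsum≡ , e | there (here refl) = 1 + y , cong (+ 1 +ℤ_) vsum≡ , expansion-+1 e
  ... | y , vsum≡ , e | there (there (here refl)) = M + y , cong (+ M +ℤ_) vsum≡ , expansion-+M e
  ... | y , vsum≡ , e | there (there (there (here refl))) =
    M + 3 + y , cong (+ (M + 3) +ℤ_) vsum≡ , expansion-+M+3 e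

  sumset-cons : ∀ {h a y} → + a ∈ A → InSumset h A (+ y) → InSumset (suc h) A (+ (a + y))
  sumset-cons {a = a} a∈A (xs , xs⊆A , vsum≡) = + a ∷ xs , a∈A ∷ xs⊆A , cong (+ a +ℤ_) vsum≡

  expansion⇒sumset : ∀ h {x} → Expansion h h x → InSumset h A (+ x)
  expansion⇒sumset zero (expansion _ _ _ z≤n z≤n z≤n refl) = [] , [] , refl
  expansion⇒sumset (suc h) (expansion (suc i) (suc k) l (s≤s i≤h) (s≤s k≤i) (s≤s i+l≤h) refl) =
    subst (InSumset (suc h) A ∘ +_) (+M+3-expansion M i k l)
      (sumset-cons (there (there (there (here refl))))
        (expansion⇒sumset h (expansion i k l i≤h k≤i i+l≤h refl)))
  expansion⇒sumset (suc h) (expansion (suc i) zero l (s≤s i≤h) z≤n (s≤s i+l≤h) refl) =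
    subst (InSumset (suc h) A ∘ +_) (+M-expansion M i 0 l)
      (sumset-cons (there (there (here refl)))
        (expansion⇒sumset h (expansion i 0 l i≤h z≤n i+l≤h refl)))
  expansion⇒sumset (suc h) (expansion zero zero (suc l) z≤n z≤n (s≤s l≤h) refl) =
    sumset-cons (there (here refl)) (expansion⇒sumset h (expansion 0 0 l z≤n z≤n l≤h refl))
  expansion⇒sumset (suc h) (expansion zero zero zero z≤n z≤n z≤n refl) =
    sumset-cons (here refl) (expansion⇒sumset h (expansion 0 0 0 z≤n z≤n z≤n refl))

  ∈-layers⇔sumset : ∀ h x → (x ∈ map +_ (layers h 0)) ⇔ InSumset h A x
  ∈-layers⇔sumset h x = mk⇔ to from
    where
    to : x ∈ map +_ (layers h 0) → InSumset h A x
    to x∈ with ∈-map⁻ +_ x∈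
    ... | y , y∈ , refl =
      expansion⇒sumset h (subst (λ n → Expansion h n y) (+-identityʳ h) (layers-sound h 0 y∈))
    from : InSumset h A x → x ∈ map +_ (layers h 0)
    from (xs , xs⊆A , refl) with sumset⇒expansion h xs xs⊆A
    ... | y , vsum≡ , e = subst (_∈ map +_ (layers h 0)) (sym vsum≡)
      (∈-map⁺ +_ (layers-complete h 0 (subst (λ n → Expansion h n y) (sym (+-identityʳ h)) e)))

  sumset-size : ∀ h → 1 ≤ h → h * 3 < M → HasSize (InSumset h A) (2 * (h * h + 1))
  sumset-size h 1≤h h*3<M =
      map +_ (layers h 0)
    , Unique.map⁺ ℤ.+-injective
        (layers-unique h 0 (subst (λ n → n * 3 < M) (sym (+-identityʳ h)) h*3<M))
    , trans (length-map +_ (layers h 0)) (length-layers-0 h 1≤h)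
    , ∈-layers⇔sumset h

corollary1 : (b : ℕ) → 1 < b →
    Σ (List ℤ) λ A → (h : ℕ) → 1 ≤ h → h ≤ b →
      HasSize (InSumset h A) (2 * (h * h + 1))
corollary1 b _ = A , λ h 1≤h h≤b → sumset-size h 1≤h (s≤s (*-monoˡ-≤ 3 h≤b))
  where open Layers (suc (b * 3))
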